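{- Let $N$ be a natural number and let $q,a,e$ be complex numbers with $e\ne0$ and such that no denominator below vanishes. Then \[ \sum_{n=1}^{N} \begin{bmatrix} N\\ n \end{bmatrix} \frac{(-1)^n (q)_{n-1}^2 a^{n} q^{n(n+1)/2} }{(a)_{n} (q/e)_{n} e^n} = -\sum_{n=1}^N \begin{bmatrix} N\\ n \end{bmatrix} \frac{(q)_{n-1} (a)_{N-n} a^n}{(a)_N } \left(\sum_{k=1}^n \frac{q^k}{e-q^{k}}\right). \]
   Context: For complex $x$: $(x)_0=1$, $(x)_n=(1-x)(1-xq)\cdots(1-xq^{n-1})$ for $n\ge1$; $(q)_{n-1}^2$ denotes $((q)_{n-1})^2$. The $q$-binomial coefficient is $\begin{bmatrix} N\\ n \end{bmatrix}=\frac{(q)_N}{(q)_n(q)_{N-n}}$ for $0\le n\le N$ and $0$ otherwise. -}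

module Defs where

open import Level using (Level; _⊔_) renaming (suc to lsuc)
open import Algebra.Bundles using (CommutativeRing)
open import Data.Nat using (ℕ; zero; suc; _∸_; _≤ᵇ_) renaming (_*_ to _*ℕ_)
open import Data.Nat.DivMod using (_/_)
open import Data.Bool using (if_then_else_)
open import Relation.Nullary using (¬_)

-- A field: a commutative ring with 1 ≠ 0 in which every nonzero element
-- has a multiplicative inverse.  `inv` is total; its value at 0 is
-- unconstrained and never used (all divisions are guarded by hypotheses).
record Field (c ℓ : Level) : Set (lsuc (c ⊔ ℓ)) where
  field
    commutativeRing : CommutativeRing c ℓ
  open CommutativeRing commutativeRing public
  field
    inv        : Carrier → Carrier
    inverse    : ∀ x → ¬ (x ≈ 0#) → x * inv x ≈ 1#
    nontrivial : ¬ (1# ≈ 0#)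

module FieldOps {c ℓ : Level} (F : Field c ℓ) where
  open Field F

  infixl 7 _÷_
  _÷_ : Carrier → Carrier → Carrier
  x ÷ y = x * inv y

  pow : Carrier → ℕ → Carrier
  pow x zero    = 1#
  pow x (suc n) = pow x n * x

  poch : (q x : Carrier) → ℕ → Carrier
  poch q x zero    = 1#
  poch q x (suc n) = poch q x n * (1# - x * pow q n)

  qbinom : (q : Carrier) → ℕ → ℕ → Carrier
  qbinom q N n = if n ≤ᵇ N
                 then poch q q N ÷ (poch q q n * poch q q (N ∸ n))
                 else 0#

  sum1 : ℕ → (ℕ → Carrier) → Carrier
  sum1 zero    f = 0#
  sum1 (suc N) f = sum1 N f + f (suc N)

  tri : ℕ → ℕ
  tri n = (n *ℕ suc n) / 2

  lhs5p10 : (N : ℕ) (q a e : Carrier) → Carrier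
  lhs5p10 N q a e = sum1 N λ n →
    qbinom q N n *
      ((pow (- 1#) n * (poch q q (n ∸ 1) * poch q q (n ∸ 1)) * pow a n * pow q (tri n))
       ÷ (poch q a n * poch q (q ÷ e) n * pow e n))

  rhs5p10 : (N : ℕ) (q a e : Carrier) → Carrier
  rhs5p10 N q a e = - (sum1 N λ n →
    qbinom q N n *
      ((poch q q (n ∸ 1) * poch q a (N ∸ n) * pow a n) ÷ poch q a N) *
      sum1 n (λ k → pow q k ÷ (e - pow q k)))

-- Both sides are expanded in the basis 1/Dₙ, where Dₙ = (e - q)(e - q²)⋯(e - qⁿ) = (q/e)ₙ eⁿ; the left
-- side is already written in it. On the right, Newton interpolation at the nodes q, q², …, qᴺ gives
-- 1/(e - qᵏ) = Σₙ (qᵏ - q)⋯(qᵏ - qⁿ⁻¹)/Dₙ exactly for k ≤ N, and by the q-Pascal rule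
-- Σ_{k≤m} qᵏ (qᵏ - q)⋯(qᵏ - qⁿ⁻¹) = (-1)ⁿ⁻¹ q^{n(n+1)/2} (q)ₙ₋₁ [m n]. Comparing coefficients of 1/Dₙ
-- leaves Σₘ [N m] [m n] (q)ₘ₋₁ (a)_{N-m} aᵐ = [N n] (q)ₙ₋₁ aⁿ (aqⁿ)_{N-n}, which after
-- [N m] [m n] = [N n] [N-n m-n] is the q-Chu–Vandermonde sum Σᵢ [M i] (b)ᵢ (a)_{M-i} aⁱ = (ab)_M at b = qⁿ.

module Submission where

open import Defs
open import Level using (Level)
open import Algebra.Bundles using (CommutativeRing)
open import Algebra.Solver.Ring.AlmostCommutativeRing
  using (fromCommutativeRing; _-Raw-AlmostCommutative⟶_)
open import Data.Bool using (true)
open import Data.Integer as ℤ using (ℤ; +_; -[1+_])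
import Data.Integer.Properties as ℤ
open import Data.Maybe using (Maybe; just; nothing)
open import Data.Nat as ℕ using (ℕ; zero; suc; _≤_; _<_; _∸_; _≤ᵇ_; z≤n; s≤s)
import Data.Nat.Properties as ℕ
open import Data.Nat.DivMod using (+-distrib-/-∣ʳ; m*n/n≡m; /-congˡ)
open import Data.Nat.Divisibility using (n∣m*n)
open import Data.Nat.Tactic.RingSolver using (solve-∀)
open import Data.Product using (_,_)
open import Relation.Nullary using (¬_; yes; no)
import Relation.Binary.PropositionalEquality as ≡

-- The ring solver needs coefficients with decidable equality; ℤ maps into every commutative ring.
module IntegerCoefficients {c ℓ : Level} (R : CommutativeRing c ℓ) where
  open CommutativeRing R
  -- With the TC-optimised _×_, ⟦ + 1 ⟧ᶻ reduces to 1#, so solver constants match the literals in goals.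
  open import Algebra.Properties.Semiring.Mult.TCOptimised semiring using (_×_; 1+×; ×-homo-+; ×1-homo-*)
  open import Algebra.Properties.Ring ring using (-‿distribˡ-*; -‿distribʳ-*)
  open import Algebra.Properties.AbelianGroup +-abelianGroup using (⁻¹-∙-comm; ε⁻¹≈ε; ⁻¹-involutive)
  open import Algebra.Properties.CommutativeSemigroup +-commutativeSemigroup using (interchange)
  open import Relation.Binary.Reasoning.Setoid setoid

  ⟦_⟧ᶻ : ℤ → Carrier
  ⟦ + n ⟧ᶻ      = n × 1#
  ⟦ -[1+ n ] ⟧ᶻ = - (suc n × 1#)

  ⊖-homo : ∀ m n → ⟦ m ℤ.⊖ n ⟧ᶻ ≈ m × 1# - n × 1#
  ⊖-homo m       zero    = trans (sym (+-identityʳ _)) (+-congˡ (sym ε⁻¹≈ε))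
  ⊖-homo zero    (suc n) = sym (+-identityˡ _)
  ⊖-homo (suc m) (suc n) = begin
    ⟦ suc m ℤ.⊖ suc n ⟧ᶻ             ≡⟨ ≡.cong ⟦_⟧ᶻ (ℤ.[1+m]⊖[1+n]≡m⊖n m n) ⟩
    ⟦ m ℤ.⊖ n ⟧ᶻ                     ≈⟨ ⊖-homo m n ⟩
    m × 1# - n × 1#                  ≈⟨ +-identityˡ _ ⟨
    0# + (m × 1# - n × 1#)           ≈⟨ +-congʳ (-‿inverseʳ 1#) ⟨
    (1# - 1#) + (m × 1# - n × 1#)    ≈⟨ interchange 1# (- 1#) (m × 1#) (- (n × 1#)) ⟩
    (1# + m × 1#) + (- 1# - n × 1#)  ≈⟨ +-congˡ (⁻¹-∙-comm 1# (n × 1#)) ⟩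
    (1# + m × 1#) - (1# + n × 1#)    ≈⟨ +-cong (1+× m 1#) (-‿cong (1+× n 1#)) ⟨
    suc m × 1# - suc n × 1#          ∎

  -‿homo : ∀ i → ⟦ ℤ.- i ⟧ᶻ ≈ - ⟦ i ⟧ᶻ
  -‿homo (+ zero)  = sym ε⁻¹≈ε
  -‿homo (+ suc n) = refl
  -‿homo -[1+ n ]  = sym (⁻¹-involutive _)

  +-homo : ∀ i j → ⟦ i ℤ.+ j ⟧ᶻ ≈ ⟦ i ⟧ᶻ + ⟦ j ⟧ᶻ
  +-homo (+ m)    (+ n)    = ×-homo-+ 1# m n
  +-homo (+ m)    -[1+ n ] = ⊖-homo m (suc n)
  +-homo -[1+ m ] (+ n)    = trans (⊖-homo n (suc m)) (+-comm _ _)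
  +-homo -[1+ m ] -[1+ n ] = begin
    - (suc (suc (m ℕ.+ n)) × 1#)     ≡⟨ ≡.cong (λ k → - (suc k × 1#)) (ℕ.+-suc m n) ⟨
    - ((suc m ℕ.+ suc n) × 1#)       ≈⟨ -‿cong (×-homo-+ 1# (suc m) (suc n)) ⟩
    - (suc m × 1# + suc n × 1#)      ≈⟨ ⁻¹-∙-comm _ _ ⟨
    - (suc m × 1#) + - (suc n × 1#)  ∎

  *-homo-pos : ∀ m n → ⟦ + m ℤ.* + n ⟧ᶻ ≈ ⟦ + m ⟧ᶻ * ⟦ + n ⟧ᶻ
  *-homo-pos m n = trans (reflexive (≡.cong ⟦_⟧ᶻ (≡.sym (ℤ.pos-* m n)))) (×1-homo-* m n)

  *-homo-posˡ : ∀ m j → ⟦ + m ℤ.* j ⟧ᶻ ≈ ⟦ + m ⟧ᶻ * ⟦ j ⟧ᶻ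
  *-homo-posˡ m (+ n)    = *-homo-pos m n
  *-homo-posˡ m -[1+ n ] = begin
    ⟦ + m ℤ.* ℤ.- + suc n ⟧ᶻ    ≡⟨ ≡.cong ⟦_⟧ᶻ (ℤ.neg-distribʳ-* (+ m) (+ suc n)) ⟨
    ⟦ ℤ.- (+ m ℤ.* + suc n) ⟧ᶻ  ≈⟨ -‿homo (+ m ℤ.* + suc n) ⟩
    - ⟦ + m ℤ.* + suc n ⟧ᶻ      ≈⟨ -‿cong (*-homo-pos m (suc n)) ⟩
    - (⟦ + m ⟧ᶻ * ⟦ + suc n ⟧ᶻ)  ≈⟨ -‿distribʳ-* _ _ ⟩
    ⟦ + m ⟧ᶻ * ⟦ -[1+ n ] ⟧ᶻ     ∎

  *-homo : ∀ i j → ⟦ i ℤ.* j ⟧ᶻ ≈ ⟦ i ⟧ᶻ * ⟦ j ⟧ᶻ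
  *-homo (+ m)    j = *-homo-posˡ m j
  *-homo -[1+ m ] j = begin
    ⟦ ℤ.- + suc m ℤ.* j ⟧ᶻ     ≡⟨ ≡.cong ⟦_⟧ᶻ (ℤ.neg-distribˡ-* (+ suc m) j) ⟨
    ⟦ ℤ.- (+ suc m ℤ.* j) ⟧ᶻ   ≈⟨ -‿homo (+ suc m ℤ.* j) ⟩
    - ⟦ + suc m ℤ.* j ⟧ᶻ       ≈⟨ -‿cong (*-homo-posˡ (suc m) j) ⟩
    - (⟦ + suc m ⟧ᶻ * ⟦ j ⟧ᶻ)  ≈⟨ -‿distribˡ-* _ _ ⟩
    ⟦ -[1+ m ] ⟧ᶻ * ⟦ j ⟧ᶻ     ∎

  homomorphism : ℤ.+-*-rawRing -Raw-AlmostCommutative⟶ fromCommutativeRing R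
  homomorphism = record
    { ⟦_⟧    = ⟦_⟧ᶻ
    ; +-homo = +-homo
    ; *-homo = *-homo
    ; -‿homo = -‿homo
    ; 0-homo = refl
    ; 1-homo = refl
    }

  equal? : ∀ i j → Maybe (⟦ i ⟧ᶻ ≈ ⟦ j ⟧ᶻ)
  equal? i j with i ℤ.≟ j
  ... | yes ≡.refl = just refl
  ... | no _       = nothing

  open import Algebra.Solver.Ring ℤ.+-*-rawRing (fromCommutativeRing R) homomorphism equal? public

  𝟘 𝟙 : ∀ {n} → Polynomial n
  𝟘 = con (+ 0)
  𝟙 = con (+ 1)

module FieldProperties {c ℓ : Level} (F : Field c ℓ) where
  open Field F
  open FieldOps F
  open import Algebra.Properties.AbelianGroup +-abelianGroup using (ε⁻¹≈ε; ⁻¹-∙-comm)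
  open import Algebra.Properties.CommutativeSemigroup +-commutativeSemigroup
    using () renaming (interchange to +-interchange)
  open import Algebra.Properties.CommutativeSemigroup *-commutativeSemigroup
    using () renaming (interchange to *-interchange)
  open import Relation.Binary.Reasoning.Setoid setoid

  ≉0-resp-≈ : ∀ {x y} → x ≈ y → x ≉ 0# → y ≉ 0#
  ≉0-resp-≈ x≈y x≉0 y≈0 = x≉0 (trans x≈y y≈0)

  inverseˡ : ∀ {x} → x ≉ 0# → inv x * x ≈ 1#
  inverseˡ {x} x≉0 = trans (*-comm (inv x) x) (inverse x x≉0)

  x*y≈z⇒y≈x⁻¹*z : ∀ {x y z} → x ≉ 0# → x * y ≈ z → y ≈ inv x * z
  x*y≈z⇒y≈x⁻¹*z {x} {y} {z} x≉0 xy≈z = begin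
    y                ≈⟨ *-identityˡ y ⟨
    1# * y           ≈⟨ *-congʳ (inverseˡ x≉0) ⟨
    (inv x * x) * y  ≈⟨ *-assoc _ _ _ ⟩
    inv x * (x * y)  ≈⟨ *-congˡ xy≈z ⟩
    inv x * z        ∎

  inv-unique : ∀ {x y} → x ≉ 0# → x * y ≈ 1# → inv x ≈ y
  inv-unique x≉0 xy≈1 = sym (trans (x*y≈z⇒y≈x⁻¹*z x≉0 xy≈1) (*-identityʳ _))

  *-cancelʳ : ∀ {x y z} → z ≉ 0# → x * z ≈ y * z → x ≈ y
  *-cancelʳ {x} {y} {z} z≉0 xz≈yz = begin
    x                ≈⟨ *-identityʳ _ ⟨
    x * 1#           ≈⟨ *-congˡ (inverse z z≉0) ⟨
    x * (z * inv z)  ≈⟨ *-assoc _ _ _ ⟨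
    (x * z) * inv z  ≈⟨ *-congʳ xz≈yz ⟩
    (y * z) * inv z  ≈⟨ *-assoc _ _ _ ⟩
    y * (z * inv z)  ≈⟨ *-congˡ (inverse z z≉0) ⟩
    y * 1#           ≈⟨ *-identityʳ _ ⟩
    y                ∎

  *-≉0 : ∀ {x y} → x ≉ 0# → y ≉ 0# → x * y ≉ 0#
  *-≉0 {x} {y} x≉0 y≉0 xy≈0 = y≉0 (*-cancelʳ x≉0 (begin
    y * x  ≈⟨ *-comm y x ⟩
    x * y  ≈⟨ xy≈0 ⟩
    0#     ≈⟨ zeroˡ x ⟨
    0# * x ∎))

  x*y≉0⇒y≉0 : ∀ {x y} → x * y ≉ 0# → y ≉ 0#
  x*y≉0⇒y≉0 {x} {y} xy≉0 y≈0 = xy≉0 (trans (*-congˡ y≈0) (zeroʳ x))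

  inv-* : ∀ {x y} → x ≉ 0# → y ≉ 0# → inv (x * y) ≈ inv x * inv y
  inv-* {x} {y} x≉0 y≉0 = inv-unique (*-≉0 x≉0 y≉0) (begin
    (x * y) * (inv x * inv y)  ≈⟨ *-interchange x y (inv x) (inv y) ⟩
    (x * inv x) * (y * inv y)  ≈⟨ *-cong (inverse x x≉0) (inverse y y≉0) ⟩
    1# * 1#                    ≈⟨ *-identityˡ 1# ⟩
    1#                         ∎)

  inv-cong : ∀ {x y} → x ≉ 0# → x ≈ y → inv x ≈ inv y
  inv-cong {x} x≉0 x≈y = sym (inv-unique (≉0-resp-≈ x≈y x≉0) (trans (*-congʳ (sym x≈y)) (inverse x x≉0)))

  inv-1# : inv 1# ≈ 1#
  inv-1# = inv-unique nontrivial (*-identityˡ 1#)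

  pow-+ : ∀ x m n → pow x (m ℕ.+ n) ≈ pow x m * pow x n
  pow-+ x m zero    = trans (reflexive (≡.cong (pow x) (ℕ.+-identityʳ m))) (sym (*-identityʳ _))
  pow-+ x m (suc n) = begin
    pow x (m ℕ.+ suc n)        ≡⟨ ≡.cong (pow x) (ℕ.+-suc m n) ⟩
    pow x (m ℕ.+ n) * x        ≈⟨ *-congʳ (pow-+ x m n) ⟩
    (pow x m * pow x n) * x    ≈⟨ *-assoc _ _ _ ⟩
    pow x m * (pow x n * x)    ∎

  pow-* : ∀ x y n → pow (x * y) n ≈ pow x n * pow y n
  pow-* x y zero    = sym (*-identityˡ 1#)
  pow-* x y (suc n) = begin
    pow (x * y) n * (x * y)        ≈⟨ *-congʳ (pow-* x y n) ⟩
    (pow x n * pow y n) * (x * y)  ≈⟨ *-interchange _ _ x y ⟩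
    (pow x n * x) * (pow y n * y)  ∎

  pow-≉0 : ∀ {x} n → x ≉ 0# → pow x n ≉ 0#
  pow-≉0 zero    x≉0 = nontrivial
  pow-≉0 (suc n) x≉0 = *-≉0 (pow-≉0 n x≉0) x≉0

  sum1-cong : ∀ N {f g : ℕ → Carrier} → (∀ n → 1 ≤ n → n ≤ N → f n ≈ g n) → sum1 N f ≈ sum1 N g
  sum1-cong zero    f≈g = refl
  sum1-cong (suc N) f≈g =
    +-cong (sum1-cong N (λ n 1≤n n≤N → f≈g n 1≤n (ℕ.m≤n⇒m≤1+n n≤N))) (f≈g (suc N) (s≤s z≤n) ℕ.≤-refl)

  sum1-≈0 : ∀ N {f : ℕ → Carrier} → (∀ n → 1 ≤ n → n ≤ N → f n ≈ 0#) → sum1 N f ≈ 0#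
  sum1-≈0 N {f} f≈0 = trans (sum1-cong N f≈0) (sum1-const0 N)
    where
    sum1-const0 : ∀ N → sum1 N (λ _ → 0#) ≈ 0#
    sum1-const0 zero    = refl
    sum1-const0 (suc N) = trans (+-identityʳ _) (sum1-const0 N)

  sum1-+ : ∀ N (f g : ℕ → Carrier) → sum1 N (λ n → f n + g n) ≈ sum1 N f + sum1 N g
  sum1-+ zero    f g = sym (+-identityˡ 0#)
  sum1-+ (suc N) f g = trans (+-congʳ (sum1-+ N f g)) (+-interchange _ _ _ _)

  sum1-*ˡ : ∀ N k (f : ℕ → Carrier) → sum1 N (λ n → k * f n) ≈ k * sum1 N f
  sum1-*ˡ zero    k f = sym (zeroʳ k)
  sum1-*ˡ (suc N) k f = trans (+-congʳ (sum1-*ˡ N k f)) (sym (distribˡ _ _ _))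

  sum1-*ʳ : ∀ N k (f : ℕ → Carrier) → sum1 N (λ n → f n * k) ≈ sum1 N f * k
  sum1-*ʳ zero    k f = sym (zeroˡ k)
  sum1-*ʳ (suc N) k f = trans (+-congʳ (sum1-*ʳ N k f)) (sym (distribʳ _ _ _))

  sum1-neg : ∀ N (f : ℕ → Carrier) → sum1 N (λ n → - f n) ≈ - sum1 N f
  sum1-neg zero    f = sym ε⁻¹≈ε
  sum1-neg (suc N) f = trans (+-congʳ (sum1-neg N f)) (⁻¹-∙-comm _ _)

  sum1-swap : ∀ M N (f : ℕ → ℕ → Carrier) →
              sum1 M (λ i → sum1 N (λ j → f i j)) ≈ sum1 N (λ j → sum1 M (λ i → f i j))
  sum1-swap zero    N f = sym (sum1-≈0 N (λ _ _ _ → refl))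
  sum1-swap (suc M) N f = trans (+-congʳ (sum1-swap M N f)) (sym (sum1-+ N _ _))

  sum1-split : ∀ K L (f : ℕ → Carrier) → sum1 (K ℕ.+ L) f ≈ sum1 K f + sum1 L (λ j → f (K ℕ.+ j))
  sum1-split K zero    f rewrite ℕ.+-identityʳ K = sym (+-identityʳ _)
  sum1-split K (suc L) f rewrite ℕ.+-suc K L     = trans (+-congʳ (sum1-split K L f)) (+-assoc _ _ _)

  sum1-sucˡ : ∀ M (f : ℕ → Carrier) → sum1 (suc M) f ≈ f 1 + sum1 M (λ i → f (suc i))
  sum1-sucˡ zero    f = trans (+-identityˡ _) (sym (+-identityʳ _))
  sum1-sucˡ (suc M) f = trans (+-congʳ (sum1-sucˡ M f)) (+-assoc _ _ _)

  sum0 : ℕ → (ℕ → Carrier) → Carrier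
  sum0 M f = f 0 + sum1 M f

  sum0-cong : ∀ M {f g : ℕ → Carrier} → (∀ i → i ≤ M → f i ≈ g i) → sum0 M f ≈ sum0 M g
  sum0-cong M f≈g = +-cong (f≈g 0 z≤n) (sum1-cong M (λ i _ i≤M → f≈g i i≤M))

  sum0-+ : ∀ M (f g : ℕ → Carrier) → sum0 M (λ n → f n + g n) ≈ sum0 M f + sum0 M g
  sum0-+ M f g = trans (+-congˡ (sum1-+ M f g)) (+-interchange _ _ _ _)

  sum0-*ˡ : ∀ M k (f : ℕ → Carrier) → sum0 M (λ n → k * f n) ≈ k * sum0 M f
  sum0-*ˡ M k f = trans (+-congˡ (sum1-*ˡ M k f)) (sym (distribˡ _ _ _))

  sum0-sucˡ : ∀ M (f : ℕ → Carrier) → sum0 (suc M) f ≈ f 0 + sum0 M (λ i → f (suc i))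
  sum0-sucˡ M f = +-congˡ (sum1-sucˡ M f)

module Gaussian {c ℓ : Level} (F : Field c ℓ) (q : Field.Carrier F) where
  open Field F
  open FieldOps F
  open FieldProperties F
  open IntegerCoefficients commutativeRing
  open import Algebra.Properties.Group +-group using (x≈y⇒x∙y⁻¹≈ε)
  open import Algebra.Properties.CommutativeSemigroup *-commutativeSemigroup using (x∙yz≈y∙xz)
  open import Relation.Binary.Reasoning.Setoid setoid

  qfac : ℕ → Carrier
  qfac = poch q q

  -- [m s] through the q-Pascal rule, which involves no division.
  gauss : ℕ → ℕ → Carrier
  gauss m       zero    = 1#
  gauss zero    (suc s) = 0#
  gauss (suc m) (suc s) = gauss m s + pow q (suc s) * gauss m (suc s)

  poch-cong : ∀ {x y} n → x ≈ y → poch q x n ≈ poch q y n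
  poch-cong zero    x≈y = refl
  poch-cong (suc n) x≈y = *-cong (poch-cong n x≈y) (+-congˡ (-‿cong (*-congʳ x≈y)))

  poch-sucˡ : ∀ x n → poch q x (suc n) ≈ (1# - x) * poch q (x * q) n
  poch-sucˡ x zero    = solve 1 (λ x → 𝟙 :* (𝟙 :- x :* 𝟙) := (𝟙 :- x) :* 𝟙) refl x
  poch-sucˡ x (suc n) = begin
    poch q x (suc n) * (1# - x * pow q (suc n))                ≈⟨ *-congʳ (poch-sucˡ x n) ⟩
    ((1# - x) * poch q (x * q) n) * (1# - x * (pow q n * q))
      ≈⟨ solve 4 (λ x P p q → ((𝟙 :- x) :* P) :* (𝟙 :- x :* (p :* q))
                              := (𝟙 :- x) :* (P :* (𝟙 :- (x :* q) :* p))) refl x (poch q (x * q) n) (pow q n) q ⟩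
    (1# - x) * poch q (x * q) (suc n)                          ∎

  poch-+ : ∀ x m n → poch q x (m ℕ.+ n) ≈ poch q x m * poch q (x * pow q m) n
  poch-+ x zero    n = trans (poch-cong n (sym (*-identityʳ x))) (sym (*-identityˡ _))
  poch-+ x (suc m) n = begin
    poch q x (suc (m ℕ.+ n))                                          ≈⟨ poch-sucˡ x (m ℕ.+ n) ⟩
    (1# - x) * poch q (x * q) (m ℕ.+ n)                               ≈⟨ *-congˡ (poch-+ (x * q) m n) ⟩
    (1# - x) * (poch q (x * q) m * poch q (x * q * pow q m) n)        ≈⟨ *-assoc _ _ _ ⟨
    ((1# - x) * poch q (x * q) m) * poch q (x * q * pow q m) n
      ≈⟨ *-cong (poch-sucˡ x m) (poch-cong n (trans (*-congˡ (*-comm (pow q m) q)) (sym (*-assoc x q (pow q m))))) ⟨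
    poch q x (suc m) * poch q (x * pow q (suc m)) n                   ∎

  gauss-vanishes : ∀ {m s} → m < s → gauss m s ≈ 0#
  gauss-vanishes {zero}  {suc s} _         = refl
  gauss-vanishes {suc m} {suc s} (s≤s m<s) = begin
    gauss m s + pow q (suc s) * gauss m (suc s)
      ≈⟨ +-cong (gauss-vanishes m<s) (*-congˡ (gauss-vanishes (ℕ.m≤n⇒m≤1+n m<s))) ⟩
    0# + pow q (suc s) * 0#  ≈⟨ solve 1 (λ x → 𝟘 :+ x :* 𝟘 := 𝟘) refl _ ⟩
    0#                       ∎

  gauss-diagonal : ∀ m → gauss m m ≈ 1#
  gauss-diagonal zero    = refl
  gauss-diagonal (suc m) = begin
    gauss m m + pow q (suc m) * gauss m (suc m)
      ≈⟨ +-cong (gauss-diagonal m) (*-congˡ (gauss-vanishes (ℕ.n<1+n m))) ⟩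
    1# + pow q (suc m) * 0#  ≈⟨ solve 1 (λ x → 𝟙 :+ x :* 𝟘 := 𝟙) refl _ ⟩
    1#                       ∎

  gauss-qfac : ∀ a b → gauss (a ℕ.+ b) a * qfac a * qfac b ≈ qfac (a ℕ.+ b)
  gauss-qfac zero    b = solve 1 (λ x → 𝟙 :* 𝟙 :* x := x) refl (qfac b)
  gauss-qfac (suc a) zero rewrite ℕ.+-identityʳ a = begin
    gauss (suc a) (suc a) * qfac (suc a) * 1#  ≈⟨ *-congʳ (*-congʳ (gauss-diagonal (suc a))) ⟩
    1# * qfac (suc a) * 1#                     ≈⟨ solve 1 (λ x → 𝟙 :* x :* 𝟙 := x) refl _ ⟩
    qfac (suc a)                               ∎
  gauss-qfac (suc a) (suc b) = begin
    (G₀ + pa₁ * G₁) * (qfac a * (1# - q * pow q a)) * (qfac b * (1# - q * pow q b))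
      ≈⟨ solve 9 (λ G₀ G₁ pa₁ Qa Qb q pa pb one →
                  (G₀ :+ pa₁ :* G₁) :* (Qa :* (one :- q :* pa)) :* (Qb :* (one :- q :* pb))
                  := (one :- q :* pa) :* (G₀ :* Qa :* (Qb :* (one :- q :* pb)))
                     :+ pa₁ :* (one :- q :* pb) :* (G₁ :* (Qa :* (one :- q :* pa)) :* Qb))
            refl G₀ G₁ pa₁ (qfac a) (qfac b) q (pow q a) (pow q b) 1# ⟩
    (1# - q * pow q a) * (G₀ * qfac a * qfac (suc b)) + pa₁ * (1# - q * pow q b) * (G₁ * qfac (suc a) * qfac b)
      ≈⟨ +-cong (*-congˡ ih₀) (*-congˡ ih₁) ⟩
    (1# - q * pow q a) * Q + pa₁ * (1# - q * pow q b) * Q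
      ≈⟨ solve 4 (λ Q pa pb q → (𝟙 :- q :* pa) :* Q :+ (pa :* q) :* (𝟙 :- q :* pb) :* Q
                                := Q :* (𝟙 :- q :* (pa :* pb :* q))) refl Q (pow q a) (pow q b) q ⟩
    Q * (1# - q * (pow q a * pow q b * q))  ≈⟨ *-congˡ (+-congˡ (-‿cong (*-congˡ (*-congʳ (pow-+ q a b))))) ⟨
    qfac (suc (suc (a ℕ.+ b)))               ≡⟨ ≡.cong (λ k → qfac (suc k)) (ℕ.+-suc a b) ⟨
    qfac (suc (a ℕ.+ suc b))                 ∎
    where
    pa₁ = pow q (suc a)
    G₀  = gauss (a ℕ.+ suc b) a
    G₁  = gauss (a ℕ.+ suc b) (suc a)
    Q   = qfac (suc (a ℕ.+ b))
    ih₀ : G₀ * qfac a * qfac (suc b) ≈ Q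
    ih₀ = ≡.subst (λ k → G₀ * qfac a * qfac (suc b) ≈ qfac k) (ℕ.+-suc a b) (gauss-qfac a (suc b))
    ih₁ : G₁ * qfac (suc a) * qfac b ≈ Q
    ih₁ = ≡.subst (λ k → gauss k (suc a) * qfac (suc a) * qfac b ≈ Q)
                  (≡.sym (ℕ.+-suc a b)) (gauss-qfac (suc a) b)

  gauss-ratio : ∀ m s →
    pow q (suc s) * (1# - pow q (suc s)) * gauss m (suc s) ≈ (pow q (suc s) - pow q (suc m)) * gauss m s
  gauss-ratio zero    zero    = solve 1 (λ p → p :* (𝟙 :- p) :* 𝟘 := (p :- p) :* 𝟙) refl _
  gauss-ratio zero    (suc s) = solve 2 (λ p r → p :* (𝟙 :- p) :* 𝟘 := (p :- r) :* 𝟘) refl _ _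
  gauss-ratio (suc m) zero    = begin
    p₁ * (1# - p₁) * (1# + p₁ * gauss m 1)
      ≈⟨ solve 2 (λ p X → p :* (𝟙 :- p) :* (𝟙 :+ p :* X)
                          := p :* (𝟙 :- p) :+ p :* (p :* (𝟙 :- p) :* X)) refl p₁ (gauss m 1) ⟩
    p₁ * (1# - p₁) + p₁ * (p₁ * (1# - p₁) * gauss m 1)  ≈⟨ +-congˡ (*-congˡ (gauss-ratio m 0)) ⟩
    p₁ * (1# - p₁) + p₁ * ((p₁ - pow q (suc m)) * 1#)
      ≈⟨ solve 2 (λ q pm → (𝟙 :* q) :* (𝟙 :- 𝟙 :* q) :+ (𝟙 :* q) :* ((𝟙 :* q :- pm) :* 𝟙)
                          := (𝟙 :* q :- pm :* q) :* 𝟙) refl q (pow q (suc m)) ⟩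
    (p₁ - pow q (suc (suc m))) * 1#                     ∎
    where
    p₁ = pow q 1
  gauss-ratio (suc m) (suc t) = begin
    p₂ * (1# - p₂) * (G₁ + p₂ * G₂)
      ≈⟨ solve 3 (λ p X Y → p :* (𝟙 :- p) :* (X :+ p :* Y)
                            := p :* (𝟙 :- p) :* X :+ p :* (p :* (𝟙 :- p) :* Y)) refl p₂ G₁ G₂ ⟩
    p₂ * (1# - p₂) * G₁ + p₂ * (p₂ * (1# - p₂) * G₂)        ≈⟨ +-congˡ (*-congˡ (gauss-ratio m (suc t))) ⟩
    p₂ * (1# - p₂) * G₁ + p₂ * ((p₂ - pm) * G₁)
      ≈⟨ solve 4 (λ p₁ q pm X → (p₁ :* q) :* (𝟙 :- p₁ :* q) :* X :+ (p₁ :* q) :* ((p₁ :* q :- pm) :* X)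
                               := q :* (p₁ :* (𝟙 :- p₁) :* X) :+ (q :* (p₁ :- pm)) :* p₁ :* X) refl p₁ q pm G₁ ⟩
    q * (p₁ * (1# - p₁) * G₁) + (q * (p₁ - pm)) * p₁ * G₁  ≈⟨ +-congʳ (*-congˡ (gauss-ratio m t)) ⟩
    q * ((p₁ - pm) * G₀) + (q * (p₁ - pm)) * p₁ * G₁
      ≈⟨ solve 5 (λ p₁ q pm X Z → q :* ((p₁ :- pm) :* Z) :+ (q :* (p₁ :- pm)) :* p₁ :* X
                                 := (p₁ :* q :- pm :* q) :* (Z :+ p₁ :* X)) refl p₁ q pm G₁ G₀ ⟩
    (p₂ - pow q (suc (suc m))) * (G₀ + p₁ * G₁)              ∎
    where
    p₁ = pow q (suc t)
    p₂ = pow q (suc (suc t))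
    pm = pow q (suc m)
    G₀ = gauss m t
    G₁ = gauss m (suc t)
    G₂ = gauss m (suc (suc t))

  gauss-pascal′ : ∀ m s →
    pow q (suc s) * gauss (suc m) (suc s) ≈ pow q (suc s) * gauss m (suc s) + pow q (suc m) * gauss m s
  gauss-pascal′ m s = begin
    p * (G₀ + p * G₁)
      ≈⟨ solve 4 (λ p pm X Y → p :* (X :+ p :* Y)
                              := (p :* Y :+ pm :* X) :+ ((p :- pm) :* X :- p :* (𝟙 :- p) :* Y)) refl p pm G₀ G₁ ⟩
    (p * G₁ + pm * G₀) + ((p - pm) * G₀ - p * (1# - p) * G₁)  ≈⟨ +-congˡ (x≈y⇒x∙y⁻¹≈ε (sym (gauss-ratio m s))) ⟩
    (p * G₁ + pm * G₀) + 0#                                    ≈⟨ +-identityʳ _ ⟩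
    p * G₁ + pm * G₀                                           ∎
    where
    p  = pow q (suc s)
    pm = pow q (suc m)
    G₀ = gauss m s
    G₁ = gauss m (suc s)

  vandermondeTerm : ℕ → Carrier → Carrier → ℕ → Carrier
  vandermondeTerm M a b i = gauss M i * poch q b i * poch q a (M ∸ i) * pow a i

  chu-vandermonde-lower : ∀ M → (∀ a b → sum0 M (vandermondeTerm M a b) ≈ poch q (a * b) M) → ∀ a b →
    sum0 M (λ i → gauss M i * poch q b (suc i) * poch q a (M ∸ i) * pow a (suc i))
      ≈ (a * (1# - b)) * poch q (a * b * q) M
  chu-vandermonde-lower M ih a b = begin
    sum0 M (λ i → gauss M i * poch q b (suc i) * poch q a (M ∸ i) * pow a (suc i))  ≈⟨ sum0-cong M (λ i _ → term i) ⟩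
    sum0 M (λ i → (a * (1# - b)) * vandermondeTerm M a (b * q) i)                  ≈⟨ sum0-*ˡ M _ _ ⟩
    (a * (1# - b)) * sum0 M (vandermondeTerm M a (b * q))                          ≈⟨ *-congˡ (ih a (b * q)) ⟩
    (a * (1# - b)) * poch q (a * (b * q)) M
      ≈⟨ *-congˡ (poch-cong M (*-assoc a b q)) ⟨
    (a * (1# - b)) * poch q (a * b * q) M                                          ∎
    where
    term : ∀ i → gauss M i * poch q b (suc i) * poch q a (M ∸ i) * pow a (suc i)
                   ≈ (a * (1# - b)) * vandermondeTerm M a (b * q) i
    term i = begin
      gauss M i * poch q b (suc i) * poch q a (M ∸ i) * (pow a i * a)
        ≈⟨ *-congʳ (*-congʳ (*-congˡ (poch-sucˡ b i))) ⟩
      gauss M i * ((1# - b) * poch q (b * q) i) * poch q a (M ∸ i) * (pow a i * a)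
        ≈⟨ solve 6 (λ a b X P A x → X :* ((𝟙 :- b) :* P) :* A :* (x :* a)
                                   := (a :* (𝟙 :- b)) :* (X :* P :* A :* x)) refl a b _ _ _ _ ⟩
      (a * (1# - b)) * vandermondeTerm M a (b * q) i ∎

  chu-vandermonde-upper : ∀ M → (∀ a b → sum0 M (vandermondeTerm M a b) ≈ poch q (a * b) M) → ∀ a b →
    sum0 (suc M) (λ i → pow q i * gauss M i * poch q b i * poch q a (suc M ∸ i) * pow a i)
      ≈ (1# - a) * poch q (a * b * q) M
  chu-vandermonde-upper M ih a b = begin
    sum0 (suc M) f                                          ≈⟨ +-assoc _ _ _ ⟨
    sum0 M f + f (suc M)                                    ≈⟨ +-congˡ top ⟩
    sum0 M f + 0#                                           ≈⟨ +-identityʳ _ ⟩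
    sum0 M f                                                ≈⟨ sum0-cong M term ⟩
    sum0 M (λ i → (1# - a) * vandermondeTerm M (a * q) b i)  ≈⟨ sum0-*ˡ M _ _ ⟩
    (1# - a) * sum0 M (vandermondeTerm M (a * q) b)          ≈⟨ *-congˡ (ih (a * q) b) ⟩
    (1# - a) * poch q (a * q * b) M
      ≈⟨ *-congˡ (poch-cong M (solve 3 (λ a q b → a :* q :* b := a :* b :* q) refl a q b)) ⟩
    (1# - a) * poch q (a * b * q) M                          ∎
    where
    f : ℕ → Carrier
    f i = pow q i * gauss M i * poch q b i * poch q a (suc M ∸ i) * pow a i
    top : f (suc M) ≈ 0#
    top = trans (*-congʳ (*-congʳ (*-congʳ (*-congˡ (gauss-vanishes (ℕ.n<1+n M))))))
                (solve 4 (λ p B A x → p :* 𝟘 :* B :* A :* x := 𝟘) refl _ _ _ _)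
    term : ∀ i → i ≤ M → f i ≈ (1# - a) * vandermondeTerm M (a * q) b i
    term i i≤M = begin
      pow q i * gauss M i * poch q b i * poch q a (suc M ∸ i) * pow a i
        ≡⟨ ≡.cong (λ k → pow q i * gauss M i * poch q b i * poch q a k * pow a i) (ℕ.+-∸-assoc 1 i≤M) ⟩
      pow q i * gauss M i * poch q b i * poch q a (suc (M ∸ i)) * pow a i
        ≈⟨ *-congʳ (*-congˡ (poch-sucˡ a (M ∸ i))) ⟩
      pow q i * gauss M i * poch q b i * ((1# - a) * poch q (a * q) (M ∸ i)) * pow a i
        ≈⟨ solve 6 (λ p X B a P x → p :* X :* B :* ((𝟙 :- a) :* P) :* x
                                   := (𝟙 :- a) :* (X :* B :* P :* (x :* p))) refl _ _ _ a _ _ ⟩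
      (1# - a) * (gauss M i * poch q b i * poch q (a * q) (M ∸ i) * (pow a i * pow q i))
        ≈⟨ *-congˡ (*-congˡ (pow-* a q i)) ⟨
      (1# - a) * vandermondeTerm M (a * q) b i ∎

  q-Chu-Vandermonde : ∀ M a b → sum0 M (vandermondeTerm M a b) ≈ poch q (a * b) M
  q-Chu-Vandermonde zero    a b = solve 0 (𝟙 :* 𝟙 :* 𝟙 :* 𝟙 :+ 𝟘 := 𝟙) refl
  q-Chu-Vandermonde (suc M) a b = begin
    sum0 (suc M) f                                                   ≈⟨ sum0-sucˡ M f ⟩
    f 0 + sum0 M (λ i → f (suc i))
      ≈⟨ +-congˡ (trans (sum0-cong M (λ i _ → pascal i)) (sum0-+ M lower upper)) ⟩
    f 0 + (sum0 M lower + sum0 M upper)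
      ≈⟨ solve 3 (λ x y z → x :+ (y :+ z) := y :+ (x :+ z)) refl _ _ _ ⟩
    sum0 M lower + (f 0 + sum0 M upper)
      ≈⟨ +-congˡ (+-congʳ (*-congʳ (*-congʳ (*-identityʳ _)))) ⟨
    sum0 M lower + (upper′ 0 + sum0 M upper)                         ≈⟨ +-congˡ (sum0-sucˡ M upper′) ⟨
    sum0 M lower + sum0 (suc M) upper′
      ≈⟨ +-cong (chu-vandermonde-lower M (q-Chu-Vandermonde M) a b)
                (chu-vandermonde-upper M (q-Chu-Vandermonde M) a b) ⟩
    (a * (1# - b)) * poch q (a * b * q) M + (1# - a) * poch q (a * b * q) M
      ≈⟨ solve 3 (λ a b P → (a :* (𝟙 :- b)) :* P :+ (𝟙 :- a) :* P := (𝟙 :- a :* b) :* P) refl a b _ ⟩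
    (1# - a * b) * poch q (a * b * q) M                              ≈⟨ poch-sucˡ (a * b) M ⟨
    poch q (a * b) (suc M)                                           ∎
    where
    f = vandermondeTerm (suc M) a b
    lower upper upper′ : ℕ → Carrier
    lower i  = gauss M i * poch q b (suc i) * poch q a (M ∸ i) * pow a (suc i)
    upper′ i = pow q i * gauss M i * poch q b i * poch q a (suc M ∸ i) * pow a i
    upper i  = upper′ (suc i)
    pascal : ∀ i → f (suc i) ≈ lower i + upper i
    pascal i = solve 6 (λ X Y p B A x → (X :+ p :* Y) :* B :* A :* x := X :* B :* A :* x :+ p :* Y :* B :* A :* x)
                       refl _ _ _ _ _ _

  gauss-trinomial : ∀ n i r → qfac n ≉ 0# → qfac i ≉ 0# → qfac r ≉ 0# →
    gauss (n ℕ.+ (i ℕ.+ r)) (n ℕ.+ i) * gauss (n ℕ.+ i) n ≈ gauss (n ℕ.+ (i ℕ.+ r)) n * gauss (i ℕ.+ r) i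
  gauss-trinomial n i r n≉0 i≉0 r≉0 = *-cancelʳ (*-≉0 (*-≉0 n≉0 i≉0) r≉0) (begin
    gauss N (n ℕ.+ i) * gauss (n ℕ.+ i) n * (qfac n * qfac i * qfac r)
      ≈⟨ solve 5 (λ A B x y z → A :* B :* (x :* y :* z) := A :* (B :* x :* y) :* z)
               refl _ _ (qfac n) (qfac i) (qfac r) ⟩
    gauss N (n ℕ.+ i) * (gauss (n ℕ.+ i) n * qfac n * qfac i) * qfac r  ≈⟨ *-congʳ (*-congˡ (gauss-qfac n i)) ⟩
    gauss N (n ℕ.+ i) * qfac (n ℕ.+ i) * qfac r                          ≈⟨ outer ⟩
    qfac N                                                               ≈⟨ gauss-qfac n (i ℕ.+ r) ⟨
    gauss N n * qfac n * qfac (i ℕ.+ r)                                  ≈⟨ *-congˡ (gauss-qfac i r) ⟨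
    gauss N n * qfac n * (gauss (i ℕ.+ r) i * qfac i * qfac r)
      ≈⟨ solve 5 (λ A B x y z → A :* x :* (B :* y :* z) := A :* B :* (x :* y :* z))
               refl _ _ (qfac n) (qfac i) (qfac r) ⟩
    gauss N n * gauss (i ℕ.+ r) i * (qfac n * qfac i * qfac r)           ∎)
    where
    N = n ℕ.+ (i ℕ.+ r)
    outer : gauss N (n ℕ.+ i) * qfac (n ℕ.+ i) * qfac r ≈ qfac N
    outer = ≡.subst (λ k → gauss k (n ℕ.+ i) * qfac (n ℕ.+ i) * qfac r ≈ qfac k)
                    (ℕ.+-assoc n i r) (gauss-qfac (n ℕ.+ i) r)

  convolutionSummand : ℕ → ℕ → Carrier → ℕ → Carrier
  convolutionSummand N n a m = gauss N m * gauss m n * qfac (m ∸ 1) * poch q a (N ∸ m) * pow a m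

  convolutionSummand-shift : ∀ s M i a → i ≤ M → (∀ k → k ≤ suc s ℕ.+ M → qfac k ≉ 0#) →
    convolutionSummand (suc s ℕ.+ M) (suc s) a (suc s ℕ.+ i)
      ≈ (gauss (suc s ℕ.+ M) (suc s) * qfac s * pow a (suc s)) * vandermondeTerm M a (pow q (suc s)) i
  convolutionSummand-shift s M i a i≤M qfac≉0 with ℕ.m≤n⇒∃[o]m+o≡n i≤M
  ... | r , ≡.refl = begin
    G₁ * G₂ * qfac (s ℕ.+ i) * poch q a (N ∸ (suc s ℕ.+ i)) * pow a (suc s ℕ.+ i)
      ≈⟨ *-cong (*-cong (*-cong trinomial qfac-split) (reflexive (≡.cong (poch q a) remaining)))
                (pow-+ a (suc s) i) ⟩
    C₁ * C₂ * (qfac s * B) * A * (pow a (suc s) * pow a i)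
      ≈⟨ solve 7 (λ C₁ C₂ Q B A x y → C₁ :* C₂ :* (Q :* B) :* A :* (x :* y) := (C₁ :* Q :* x) :* (C₂ :* B :* A :* y))
               refl C₁ C₂ (qfac s) B A (pow a (suc s)) (pow a i) ⟩
    (C₁ * qfac s * pow a (suc s)) * vandermondeTerm (i ℕ.+ r) a (pow q (suc s)) i ∎
    where
    N  = suc s ℕ.+ (i ℕ.+ r)
    G₁ = gauss N (suc s ℕ.+ i)
    G₂ = gauss (suc s ℕ.+ i) (suc s)
    C₁ = gauss N (suc s)
    C₂ = gauss (i ℕ.+ r) i
    B  = poch q (pow q (suc s)) i
    A  = poch q a (i ℕ.+ r ∸ i)
    remaining : N ∸ (suc s ℕ.+ i) ≡.≡ i ℕ.+ r ∸ i
    remaining = ℕ.[m+n]∸[m+o]≡n∸o (suc s) (i ℕ.+ r) i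
    trinomial : G₁ * G₂ ≈ C₁ * C₂
    trinomial = gauss-trinomial (suc s) i r (qfac≉0 (suc s) (ℕ.m≤m+n (suc s) M))
                  (qfac≉0 i (ℕ.≤-trans (ℕ.m≤m+n i r) (ℕ.m≤n+m M (suc s))))
                  (qfac≉0 r (ℕ.≤-trans (ℕ.m≤n+m r i) (ℕ.m≤n+m M (suc s))))
    qfac-split : qfac (s ℕ.+ i) ≈ qfac s * B
    qfac-split = trans (poch-+ q s i) (*-congˡ (poch-cong i (*-comm q (pow q s))))

  gauss-convolution : ∀ N s a → suc s ≤ N → (∀ k → k ≤ N → qfac k ≉ 0#) →
    poch q a (suc s) * sum1 N (convolutionSummand N (suc s) a)
      ≈ gauss N (suc s) * qfac s * pow a (suc s) * poch q a N
  gauss-convolution N s a s<N qfac≉0 with ℕ.m≤n⇒∃[o]m+o≡n s<N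
  ... | M , ≡.refl = begin
    poch q a (suc s) * sum1 N f                                ≈⟨ *-congˡ sum≈ ⟩
    poch q a (suc s) * (K * poch q (a * pow q (suc s)) M)      ≈⟨ x∙yz≈y∙xz _ _ _ ⟩
    K * (poch q a (suc s) * poch q (a * pow q (suc s)) M)      ≈⟨ *-congˡ (poch-+ a (suc s) M) ⟨
    K * poch q a N                                             ∎
    where
    f = convolutionSummand N (suc s) a
    K = gauss N (suc s) * qfac s * pow a (suc s)
    below : sum1 s f ≈ 0#
    below = sum1-≈0 s (λ m _ m≤s → trans (*-congʳ (*-congʳ (*-congʳ (*-congˡ (gauss-vanishes (s≤s m≤s))))))
                                          (solve 4 (λ G Q A x → G :* 𝟘 :* Q :* A :* x := 𝟘) refl _ _ _ _))
    sum≈ : sum1 N f ≈ K * poch q (a * pow q (suc s)) M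
    sum≈ = begin
      sum1 N f                                                  ≈⟨ sum1-split (suc s) M f ⟩
      sum1 s f + f (suc s) + sum1 M (λ j → f (suc s ℕ.+ j))     ≈⟨ +-congʳ (trans (+-congʳ below) (+-identityˡ _)) ⟩
      f (suc s) + sum1 M (λ j → f (suc s ℕ.+ j))
        ≡⟨ ≡.cong (λ k → f k + sum1 M (λ j → f (suc s ℕ.+ j))) (ℕ.+-identityʳ (suc s)) ⟨
      sum0 M (λ i → f (suc s ℕ.+ i))
        ≈⟨ sum0-cong M (λ i i≤M → convolutionSummand-shift s M i a i≤M qfac≉0) ⟩
      sum0 M (λ i → K * vandermondeTerm M a (pow q (suc s)) i)  ≈⟨ sum0-*ˡ M K _ ⟩
      K * sum0 M (vandermondeTerm M a (pow q (suc s)))          ≈⟨ *-congˡ (q-Chu-Vandermonde M a (pow q (suc s))) ⟩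
      K * poch q (a * pow q (suc s)) M                          ∎

  qbinom≈gauss : ∀ {N n} → n ≤ N → qfac n ≉ 0# → qfac (N ∸ n) ≉ 0# → qbinom q N n ≈ gauss N n
  qbinom≈gauss {N} {n} n≤N n≉0 N-n≉0 with n ≤ᵇ N | ℕ.≤⇒≤ᵇ n≤N
  ... | true | _ = begin
    qfac N * inv (qfac n * qfac (N ∸ n))                                       ≈⟨ *-congʳ factorised ⟨
    (gauss N n * qfac n * qfac (N ∸ n)) * inv (qfac n * qfac (N ∸ n))
      ≈⟨ trans (*-congʳ (*-assoc _ _ _)) (*-assoc _ _ _) ⟩
    gauss N n * ((qfac n * qfac (N ∸ n)) * inv (qfac n * qfac (N ∸ n)))
      ≈⟨ *-congˡ (inverse _ (*-≉0 n≉0 N-n≉0)) ⟩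
    gauss N n * 1#                                                            ≈⟨ *-identityʳ _ ⟩
    gauss N n                                                                 ∎
    where
    factorised : gauss N n * qfac n * qfac (N ∸ n) ≈ qfac N
    factorised = ≡.subst (λ k → gauss k n * qfac n * qfac (N ∸ n) ≈ qfac k) (ℕ.m+[n∸m]≡n n≤N) (gauss-qfac n (N ∸ n))

module NewtonExpansion {c ℓ : Level} (F : Field c ℓ) (q : Field.Carrier F) where
  open Field F
  open FieldOps F
  open FieldProperties F
  open Gaussian F q
  open IntegerCoefficients commutativeRing
  open import Algebra.Properties.Group +-group using (x≈y⇒x∙y⁻¹≈ε; ε⁻¹≈ε)
  open import Relation.Binary.Reasoning.Setoid setoid

  tri-suc : ∀ n → tri (suc n) ≡.≡ tri n ℕ.+ suc n
  tri-suc n = ≡.trans (/-congˡ (double n))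
    (≡.trans (+-distrib-/-∣ʳ (n ℕ.* suc n) (n∣m*n (suc n))) (≡.cong (tri n ℕ.+_) (m*n/n≡m (suc n) 2)))
    where
    double : ∀ n → suc n ℕ.* suc (suc n) ≡.≡ n ℕ.* suc n ℕ.+ suc n ℕ.* 2
    double = solve-∀

  pow-tri-suc : ∀ n → pow q (tri (suc n)) ≈ pow q (tri n) * pow q (suc n)
  pow-tri-suc n = trans (reflexive (≡.cong (pow q) (tri-suc n))) (pow-+ q (tri n) (suc n))

  newtonBasis : Carrier → ℕ → Carrier
  newtonBasis x zero    = 1#
  newtonBasis x (suc n) = newtonBasis x n * (x - pow q (suc n))

  poch-q÷e≈newtonBasis : ∀ {e} → e ≉ 0# → ∀ n → poch q (q ÷ e) n * pow e n ≈ newtonBasis e n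
  poch-q÷e≈newtonBasis e≉0 zero    = *-identityˡ 1#
  poch-q÷e≈newtonBasis {e} e≉0 (suc n) = begin
    poch q (q ÷ e) n * (1# - q * inv e * pow q n) * (pow e n * e)
      ≈⟨ solve 6 (λ P E q e′ p e → P :* (𝟙 :- q :* e′ :* p) :* (E :* e)
                                  := (P :* E) :* (e :- p :* q :* (e :* e′))) refl _ _ q (inv e) (pow q n) e ⟩
    (poch q (q ÷ e) n * pow e n) * (e - pow q n * q * (e * inv e))
      ≈⟨ *-cong (poch-q÷e≈newtonBasis e≉0 n) (+-congˡ (-‿cong (trans (*-congˡ (inverse e e≉0)) (*-identityʳ _)))) ⟩
    newtonBasis e n * (e - pow q n * q) ∎

  newtonBasis-root : ∀ k n → 1 ≤ k → k ≤ n → newtonBasis (pow q k) n ≈ 0#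
  newtonBasis-root (suc k) zero    _   ()
  newtonBasis-root k       (suc n) 1≤k k≤1+n with k ℕ.≟ suc n
  ... | yes ≡.refl = trans (*-congˡ (-‿inverseʳ _)) (zeroʳ _)
  ... | no k≢1+n   = trans (*-congʳ (newtonBasis-root k n 1≤k (ℕ.≤-pred (ℕ.≤∧≢⇒< k≤1+n k≢1+n)))) (zeroˡ _)

  newtonBasis-qpow : ∀ m s → newtonBasis (pow q (suc m)) s ≈ pow (- 1#) s * pow q (tri s) * qfac s * gauss m s
  newtonBasis-qpow m zero    = solve 0 (𝟙 := 𝟙 :* 𝟙 :* 𝟙 :* 𝟙) refl
  newtonBasis-qpow m (suc s) = begin
    newtonBasis pm s * (pm - p)                                  ≈⟨ *-congʳ (newtonBasis-qpow m s) ⟩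
    (σ * T * Q * gauss m s) * (pm - p)
      ≈⟨ solve 6 (λ σ T Q G pm p → (σ :* T :* Q :* G) :* (pm :- p) := (:- (σ :* T :* Q)) :* ((p :- pm) :* G))
               refl σ T Q (gauss m s) pm p ⟩
    (- (σ * T * Q)) * ((p - pm) * gauss m s)                     ≈⟨ *-congˡ (gauss-ratio m s) ⟨
    (- (σ * T * Q)) * (p * (1# - p) * gauss m (suc s))
      ≈⟨ solve 6 (λ σ T Q G p q → (:- (σ :* T :* Q)) :* ((p :* q) :* (𝟙 :- p :* q) :* G)
                                 := (σ :* (:- 𝟙)) :* (T :* (p :* q)) :* (Q :* (𝟙 :- q :* p)) :* G)
              refl σ T Q (gauss m (suc s)) (pow q s) q ⟩
    pow (- 1#) (suc s) * (T * pow q (suc s)) * qfac (suc s) * gauss m (suc s)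
      ≈⟨ *-congʳ (*-congʳ (*-congˡ (pow-tri-suc s))) ⟨
    pow (- 1#) (suc s) * pow q (tri (suc s)) * qfac (suc s) * gauss m (suc s) ∎
    where
    σ  = pow (- 1#) s
    T  = pow q (tri s)
    Q  = qfac s
    pm = pow q (suc m)
    p  = pow q (suc s)

  newton-telescope : ∀ e c M → (∀ n → n ≤ M → newtonBasis e n ≉ 0#) →
    (e - c) * sum1 M (λ n → newtonBasis c (n ∸ 1) * inv (newtonBasis e n))
      ≈ 1# - newtonBasis c M * inv (newtonBasis e M)
  newton-telescope e c zero    _   = begin
    (e - c) * 0#     ≈⟨ zeroʳ _ ⟩
    0#               ≈⟨ -‿inverseʳ 1# ⟨
    1# - 1#          ≈⟨ +-congˡ (-‿cong (trans (*-identityˡ _) inv-1#)) ⟨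
    1# - 1# * inv 1# ∎
  newton-telescope e c (suc M) D≉0 = begin
    (e - c) * (S + P * inv (D (suc M)))             ≈⟨ *-congˡ (+-congˡ (*-congˡ inv-D)) ⟩
    (e - c) * (S + P * (d⁻¹ * u⁻¹))                 ≈⟨ distribˡ _ _ _ ⟩
    (e - c) * S + (e - c) * (P * (d⁻¹ * u⁻¹))
      ≈⟨ +-congʳ (newton-telescope e c M (λ n n≤M → D≉0 n (ℕ.m≤n⇒m≤1+n n≤M))) ⟩
    (1# - P * d⁻¹) + (e - c) * (P * (d⁻¹ * u⁻¹))
      ≈⟨ solve 6 (λ e c P d⁻¹ u⁻¹ p → (𝟙 :- P :* d⁻¹) :+ (e :- c) :* (P :* (d⁻¹ :* u⁻¹))
                  := (𝟙 :- (P :* (c :- p)) :* (d⁻¹ :* u⁻¹)) :+ (P :* d⁻¹ :* ((e :- p) :* u⁻¹) :- P :* d⁻¹))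
              refl e c P d⁻¹ u⁻¹ (pow q (suc M)) ⟩
    (1# - (P * (c - pow q (suc M))) * (d⁻¹ * u⁻¹)) + (P * d⁻¹ * (u * u⁻¹) - P * d⁻¹)
      ≈⟨ +-congˡ (x≈y⇒x∙y⁻¹≈ε (trans (*-congˡ (inverse u u≉0)) (*-identityʳ _))) ⟩
    (1# - (P * (c - pow q (suc M))) * (d⁻¹ * u⁻¹)) + 0#  ≈⟨ +-identityʳ _ ⟩
    1# - (P * (c - pow q (suc M))) * (d⁻¹ * u⁻¹)         ≈⟨ +-congˡ (-‿cong (*-congˡ inv-D)) ⟨
    1# - newtonBasis c (suc M) * inv (D (suc M))         ∎
    where
    D   = newtonBasis e
    S   = sum1 M (λ n → newtonBasis c (n ∸ 1) * inv (D n))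
    P   = newtonBasis c M
    u   = e - pow q (suc M)
    d⁻¹ = inv (D M)
    u⁻¹ = inv u
    u≉0 : u ≉ 0#
    u≉0 = x*y≉0⇒y≉0 (D≉0 (suc M) ℕ.≤-refl)
    inv-D : inv (D (suc M)) ≈ d⁻¹ * u⁻¹
    inv-D = inv-* (D≉0 M (ℕ.n≤1+n M)) u≉0

  inv-newton : ∀ e N k → 1 ≤ k → k ≤ N → (∀ n → n ≤ N → newtonBasis e n ≉ 0#) →
    inv (e - pow q k) ≈ sum1 N (λ n → newtonBasis (pow q k) (n ∸ 1) * inv (newtonBasis e n))
  inv-newton e N (suc j) 1≤k k≤N D≉0 = inv-unique (x*y≉0⇒y≉0 (D≉0 (suc j) k≤N)) (begin
    (e - pow q (suc j)) * sum1 N (λ n → newtonBasis (pow q (suc j)) (n ∸ 1) * inv (newtonBasis e n))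
      ≈⟨ newton-telescope e (pow q (suc j)) N D≉0 ⟩
    1# - newtonBasis (pow q (suc j)) N * inv (newtonBasis e N)
      ≈⟨ +-congˡ (-‿cong (trans (*-congʳ (newtonBasis-root (suc j) N 1≤k k≤N)) (zeroˡ _))) ⟩
    1# - 0#  ≈⟨ trans (+-congˡ ε⁻¹≈ε) (+-identityʳ 1#) ⟩
    1#       ∎)

  newtonCoefficient : ℕ → ℕ → Carrier
  newtonCoefficient m n = sum1 m (λ k → pow q k * newtonBasis (pow q k) (n ∸ 1))

  newtonCoefficient-suc : ∀ m s →
    newtonCoefficient m (suc s) ≈ pow (- 1#) s * pow q (tri (suc s)) * qfac s * gauss m (suc s)
  newtonCoefficient-suc zero    s = sym (zeroʳ _)
  newtonCoefficient-suc (suc m) s = begin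
    newtonCoefficient m (suc s) + pm * newtonBasis pm s
      ≈⟨ +-cong (trans (newtonCoefficient-suc m s) (*-congʳ (*-congʳ (*-congˡ (pow-tri-suc s)))))
                (*-congˡ (newtonBasis-qpow m s)) ⟩
    σ * (T * p) * Q * gauss m (suc s) + pm * (σ * T * Q * gauss m s)
      ≈⟨ solve 7 (λ σ T p Q G₁ G₀ pm → σ :* (T :* p) :* Q :* G₁ :+ pm :* (σ :* T :* Q :* G₀)
                                      := (σ :* T :* Q) :* (p :* G₁ :+ pm :* G₀))
               refl σ T p Q (gauss m (suc s)) (gauss m s) pm ⟩
    (σ * T * Q) * (p * gauss m (suc s) + pm * gauss m s)   ≈⟨ *-congˡ (gauss-pascal′ m s) ⟨
    (σ * T * Q) * (p * gauss (suc m) (suc s))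
      ≈⟨ solve 5 (λ σ T Q p G → (σ :* T :* Q) :* (p :* G) := σ :* (T :* p) :* Q :* G)
               refl σ T Q p (gauss (suc m) (suc s)) ⟩
    σ * (T * p) * Q * gauss (suc m) (suc s)                ≈⟨ *-congʳ (*-congʳ (*-congˡ (pow-tri-suc s))) ⟨
    σ * pow q (tri (suc s)) * Q * gauss (suc m) (suc s)    ∎
    where
    σ  = pow (- 1#) s
    T  = pow q (tri s)
    Q  = qfac s
    pm = pow q (suc m)
    p  = pow q (suc s)

  harmonic-newton : ∀ e N m → m ≤ N → (∀ n → n ≤ N → newtonBasis e n ≉ 0#) →
    sum1 m (λ k → pow q k ÷ (e - pow q k)) ≈ sum1 N (λ n → newtonCoefficient m n * inv (newtonBasis e n))
  harmonic-newton e N m m≤N D≉0 = begin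
    sum1 m (λ k → pow q k * inv (e - pow q k))
      ≈⟨ sum1-cong m (λ k 1≤k k≤m → *-congˡ (inv-newton e N k 1≤k (ℕ.≤-trans k≤m m≤N) D≉0)) ⟩
    sum1 m (λ k → pow q k * sum1 N (λ n → b k n * inv (D n)))
      ≈⟨ sum1-cong m (λ k _ _ → sum1-*ˡ N (pow q k) _) ⟨
    sum1 m (λ k → sum1 N (λ n → pow q k * (b k n * inv (D n))))
      ≈⟨ sum1-swap m N _ ⟩
    sum1 N (λ n → sum1 m (λ k → pow q k * (b k n * inv (D n))))
      ≈⟨ sum1-cong N (λ n _ _ → trans (sum1-cong m (λ k _ _ → sym (*-assoc _ _ _))) (sum1-*ʳ m (inv (D n)) _)) ⟩
    sum1 N (λ n → newtonCoefficient m n * inv (D n)) ∎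
    where
    D = newtonBasis e
    b : ℕ → ℕ → Carrier
    b k n = newtonBasis (pow q k) (n ∸ 1)

module Theorem5p10 {c ℓ : Level} (F : Field c ℓ) where
  open Field F
  open FieldOps F

  module NewtonCoefficients (N : ℕ) (q a e : Carrier)
    (e≉0 : e ≉ 0#)
    (qfac≉0 : ∀ n → n ≤ N → poch q q n ≉ 0#)
    (poch-a≉0 : ∀ n → n ≤ N → poch q a n ≉ 0#)
    (poch-q÷e≉0 : ∀ n → n ≤ N → poch q (q ÷ e) n ≉ 0#)
    where
    open FieldProperties F
    open Gaussian F q
    open NewtonExpansion F q
    open IntegerCoefficients commutativeRing
    open import Algebra.Properties.Ring ring using (-‿distribˡ-*)
    open import Relation.Binary.Reasoning.Setoid setoid

    D : ℕ → Carrier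
    D = newtonBasis e

    D≉0 : ∀ n → n ≤ N → D n ≉ 0#
    D≉0 n n≤N = ≉0-resp-≈ (poch-q÷e≈newtonBasis e≉0 n) (*-≉0 (poch-q÷e≉0 n n≤N) (pow-≉0 n e≉0))

    qbinom≈gaussN : ∀ n → n ≤ N → qbinom q N n ≈ gauss N n
    qbinom≈gaussN n n≤N = qbinom≈gauss n≤N (qfac≉0 n n≤N) (qfac≉0 (N ∸ n) (ℕ.m∸n≤m N n))

    lhsCoefficient : ℕ → Carrier
    lhsCoefficient n =
      gauss N n * (pow (- 1#) n * (qfac (n ∸ 1) * qfac (n ∸ 1)) * pow a n * pow q (tri n)) * inv (poch q a n)

    rhsWeight : ℕ → Carrier
    rhsWeight m = gauss N m * (qfac (m ∸ 1) * poch q a (N ∸ m) * pow a m * inv (poch q a N))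

    rhsCoefficient : ℕ → Carrier
    rhsCoefficient n = - sum1 N (λ m → rhsWeight m * newtonCoefficient m n)

    lhs≈newton : lhs5p10 N q a e ≈ sum1 N (λ n → lhsCoefficient n * inv (D n))
    lhs≈newton = sum1-cong N term
      where
      term : ∀ n → 1 ≤ n → n ≤ N →
        qbinom q N n * ((pow (- 1#) n * (qfac (n ∸ 1) * qfac (n ∸ 1)) * pow a n * pow q (tri n))
                        ÷ (poch q a n * poch q (q ÷ e) n * pow e n))
          ≈ lhsCoefficient n * inv (D n)
      term n _ n≤N = begin
        qbinom q N n * (X * inv (A * E * pow e n))  ≈⟨ *-cong (qbinom≈gaussN n n≤N) (*-congˡ inv-denominator) ⟩
        gauss N n * (X * (inv A * inv (D n)))
          ≈⟨ solve 4 (λ G X A D → G :* (X :* (A :* D)) := G :* X :* A :* D) refl _ _ _ _ ⟩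
        lhsCoefficient n * inv (D n)                ∎
        where
        X = pow (- 1#) n * (qfac (n ∸ 1) * qfac (n ∸ 1)) * pow a n * pow q (tri n)
        A = poch q a n
        E = poch q (q ÷ e) n
        Ee≉0 : E * pow e n ≉ 0#
        Ee≉0 = *-≉0 (poch-q÷e≉0 n n≤N) (pow-≉0 n e≉0)
        inv-denominator : inv (A * E * pow e n) ≈ inv A * inv (D n)
        inv-denominator = begin
          inv (A * E * pow e n)
            ≈⟨ inv-cong (*-≉0 (*-≉0 (poch-a≉0 n n≤N) (poch-q÷e≉0 n n≤N)) (pow-≉0 n e≉0)) (*-assoc _ _ _) ⟩
          inv (A * (E * pow e n))  ≈⟨ inv-* (poch-a≉0 n n≤N) Ee≉0 ⟩
          inv A * inv (E * pow e n) ≈⟨ *-congˡ (inv-cong Ee≉0 (poch-q÷e≈newtonBasis e≉0 n)) ⟩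
          inv A * inv (D n)        ∎

    rhs≈newton : rhs5p10 N q a e ≈ sum1 N (λ n → rhsCoefficient n * inv (D n))
    rhs≈newton = begin
      rhs5p10 N q a e                                                      ≈⟨ -‿cong (sum1-cong N term) ⟩
      - sum1 N (λ m → sum1 N (λ n → rhsWeight m * W m n * inv (D n)))      ≈⟨ -‿cong (sum1-swap N N _) ⟩
      - sum1 N (λ n → sum1 N (λ m → rhsWeight m * W m n * inv (D n)))
        ≈⟨ -‿cong (sum1-cong N (λ n _ _ → sum1-*ʳ N (inv (D n)) _)) ⟩
      - sum1 N (λ n → sum1 N (λ m → rhsWeight m * W m n) * inv (D n))      ≈⟨ sum1-neg N _ ⟨
      sum1 N (λ n → - (sum1 N (λ m → rhsWeight m * W m n) * inv (D n)))
        ≈⟨ sum1-cong N (λ n _ _ → -‿distribˡ-* _ _) ⟩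
      sum1 N (λ n → rhsCoefficient n * inv (D n))                          ∎
      where
      W = newtonCoefficient
      H : ℕ → Carrier
      H m = sum1 m (λ k → pow q k ÷ (e - pow q k))
      term : ∀ m → 1 ≤ m → m ≤ N →
        qbinom q N m * ((qfac (m ∸ 1) * poch q a (N ∸ m) * pow a m) ÷ poch q a N) * H m
          ≈ sum1 N (λ n → rhsWeight m * W m n * inv (D n))
      term m _ m≤N = begin
        qbinom q N m * ((qfac (m ∸ 1) * poch q a (N ∸ m) * pow a m) ÷ poch q a N) * H m
          ≈⟨ *-cong (*-congʳ (qbinom≈gaussN m m≤N)) (harmonic-newton e N m m≤N D≉0) ⟩
        rhsWeight m * sum1 N (λ n → W m n * inv (D n))   ≈⟨ sum1-*ˡ N (rhsWeight m) _ ⟨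
        sum1 N (λ n → rhsWeight m * (W m n * inv (D n))) ≈⟨ sum1-cong N (λ n _ _ → *-assoc _ _ _) ⟨
        sum1 N (λ n → rhsWeight m * W m n * inv (D n))   ∎

    coefficients-agree : ∀ n → 1 ≤ n → n ≤ N → lhsCoefficient n ≈ rhsCoefficient n
    coefficients-agree (suc s) _ s<N = sym (begin
      - sum1 N (λ m → rhsWeight m * newtonCoefficient m (suc s))  ≈⟨ -‿cong (sum1-cong N (λ m _ _ → weighted m)) ⟩
      - sum1 N (λ m → (Aₙ⁻¹ * G) * f m)                           ≈⟨ -‿cong (sum1-*ˡ N _ _) ⟩
      - ((Aₙ⁻¹ * G) * sum1 N f)                                   ≈⟨ -‿cong (*-congˡ convolution) ⟩
      - ((Aₙ⁻¹ * G) * (Aₛ⁻¹ * (K * Aₙ)))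
        ≈⟨ solve 5 (λ Aₙ⁻¹ G Aₛ⁻¹ K Aₙ → :- ((Aₙ⁻¹ :* G) :* (Aₛ⁻¹ :* (K :* Aₙ)))
                                       := (:- (G :* Aₛ⁻¹ :* K)) :* (Aₙ :* Aₙ⁻¹))
                refl Aₙ⁻¹ G Aₛ⁻¹ K Aₙ ⟩
      (- (G * Aₛ⁻¹ * K)) * (Aₙ * Aₙ⁻¹)                            ≈⟨ *-congˡ (inverse Aₙ (poch-a≉0 N ℕ.≤-refl)) ⟩
      (- (G * Aₛ⁻¹ * K)) * 1#
        ≈⟨ solve 6 (λ σ T Q Aₛ⁻¹ C x → (:- (σ :* T :* Q :* Aₛ⁻¹ :* (C :* Q :* x))) :* 𝟙
                                      := C :* (σ :* (:- 𝟙) :* (Q :* Q) :* x :* T) :* Aₛ⁻¹)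
                refl (pow (- 1#) s) (pow q (tri (suc s))) (qfac s) Aₛ⁻¹ (gauss N (suc s)) (pow a (suc s)) ⟩
      lhsCoefficient (suc s)                                      ∎)
      where
      G    = pow (- 1#) s * pow q (tri (suc s)) * qfac s
      K    = gauss N (suc s) * qfac s * pow a (suc s)
      Aₙ   = poch q a N
      Aₙ⁻¹ = inv Aₙ
      Aₛ⁻¹ = inv (poch q a (suc s))
      f    = convolutionSummand N (suc s) a
      convolution : sum1 N f ≈ Aₛ⁻¹ * (K * Aₙ)
      convolution = x*y≈z⇒y≈x⁻¹*z (poch-a≉0 (suc s) s<N) (gauss-convolution N s a s<N qfac≉0)
      weighted : ∀ m → rhsWeight m * newtonCoefficient m (suc s) ≈ (Aₙ⁻¹ * G) * f m
      weighted m = begin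
        rhsWeight m * newtonCoefficient m (suc s)
          ≈⟨ *-congˡ (newtonCoefficient-suc m s) ⟩
        gauss N m * (qfac (m ∸ 1) * poch q a (N ∸ m) * pow a m * Aₙ⁻¹) * (G * gauss m (suc s))
          ≈⟨ solve 7 (λ C Q A x Aₙ⁻¹ G C′ → C :* (Q :* A :* x :* Aₙ⁻¹) :* (G :* C′)
                                           := (Aₙ⁻¹ :* G) :* (C :* C′ :* Q :* A :* x))
                  refl (gauss N m) (qfac (m ∸ 1)) (poch q a (N ∸ m)) (pow a m) Aₙ⁻¹ G (gauss m (suc s)) ⟩
        (Aₙ⁻¹ * G) * f m                                                                   ∎

theorem5p10 : ∀ {c ℓ} (F : Field c ℓ) → let open Field F in let open FieldOps F in
    (N : ℕ) (q a e : Carrier) →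
    ¬ (e ≈ 0#) →
    (∀ n → n ≤ N → ¬ (poch q q n ≈ 0#)) →
    (∀ n → n ≤ N → ¬ (poch q a n ≈ 0#)) →
    (∀ n → n ≤ N → ¬ (poch q (q ÷ e) n ≈ 0#)) →
    (∀ k → 1 ≤ k → k ≤ N → ¬ (e - pow q k ≈ 0#)) →
    lhs5p10 N q a e ≈ rhs5p10 N q a e
theorem5p10 F N q a e e≉0 qfac≉0 poch-a≉0 poch-q÷e≉0 _ = begin
  lhs5p10 N q a e                                   ≈⟨ lhs≈newton ⟩
  sum1 N (λ n → lhsCoefficient n * inv (D n))
    ≈⟨ sum1-cong N (λ n 1≤n n≤N → *-congʳ (coefficients-agree n 1≤n n≤N)) ⟩
  sum1 N (λ n → rhsCoefficient n * inv (D n))       ≈⟨ rhs≈newton ⟨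
  rhs5p10 N q a e                                   ∎
  where
  open Field F
  open FieldOps F
  open FieldProperties F using (sum1-cong)
  open Theorem5p10 F
  open NewtonCoefficients N q a e e≉0 qfac≉0 poch-a≉0 poch-q÷e≉0
  open import Relation.Binary.Reasoning.Setoid setoid
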